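{- Let $\ell$ be a positive integer and let $V_1,\dots,V_\ell$ be finite sets with $|V_l|\ge 2\ell$ for every $l\in[\ell]$. Consider the procedure Distribute: initialize $\mathcal V_1=\dots=\mathcal V_\ell=\emptyset$ and $I=[\ell]$; repeat $\ell$ times: pick $j\in\arg\min_{j\in I}|V_j|$, let $\mathcal V_j$ be a uniformly random subset of size $\lfloor |V_j|/\ell\rfloor$ of $V_j\setminus\bigcup_{l\in[\ell]}\mathcal V_l$, and set $I\leftarrow I\setminus\{j\}$; return $\mathcal V_1,\dots,\mathcal V_\ell$. Then the procedure is well defined and returns pairwise disjoint sets $\mathcal V_1,\dots,\mathcal V_\ell$ with $\mathcal V_l\subseteq V_l$ and $|\mathcal V_l|\ge\frac{|V_l|}{2\ell}$ for every $l\in[\ell]$. -}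

module Defs where

open import Data.Nat using (ℕ; zero; suc; _≤_; NonZero)
open import Data.Nat.DivMod using (_/_)
open import Data.Fin using (Fin)
open import Data.Fin.Properties using (_≟_)
open import Data.Fin.Subset using (Subset; _∈_; _⊆_; _─_; _-_; ⋃; ⊥; ⊤; ∣_∣)
open import Data.List using (List; tabulate)
open import Data.Product using (Σ; _×_)
open import Relation.Binary.PropositionalEquality using (_≡_)
open import Relation.Nullary using (yes; no)

-- The sets V₁,…,V_ℓ are represented as subsets of a common finite ground
-- set Fin n (e.g. their union).
record State (n ℓ : ℕ) : Set where
  constructor ⟨_,_⟩
  field
    idx  : Subset ℓ
    sets : Fin ℓ → Subset n
open State public

bigUnion : ∀ {n ℓ} → (Fin ℓ → Subset n) → Subset n
bigUnion {ℓ = ℓ} W = ⋃ (tabulate {n = ℓ} W)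

update : ∀ {n ℓ} → (Fin ℓ → Subset n) → Fin ℓ → Subset n → Fin ℓ → Subset n
update W j S i with i ≟ j
... | yes _ = S
... | no  _ = W i

IsArgmin : ∀ {n ℓ} → (Fin ℓ → Subset n) → Subset ℓ → Fin ℓ → Set
IsArgmin V I j = (j ∈ I) × (∀ j′ → j′ ∈ I → ∣ V j ∣ ≤ ∣ V j′ ∣)

Available : ∀ {n ℓ} → (Fin ℓ → Subset n) → State n ℓ → Fin ℓ → Subset n
Available V s j = V j ─ bigUnion (sets s)

-- One iteration of the loop, for every possible tie-break choice of j and
-- every possible outcome 𝒱_j of the uniformly random subset (i.e. every
-- subset of the available set with exactly ⌊|V_j|/ℓ⌋ elements).
data Step {n ℓ : ℕ} .{{_ : NonZero ℓ}} (V : Fin ℓ → Subset n) : State n ℓ → State n ℓ → Set where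
  step : ∀ (s : State n ℓ) (j : Fin ℓ) (S : Subset n) →
         IsArgmin V (idx s) j →
         S ⊆ Available V s j →
         ∣ S ∣ ≡ ∣ V j ∣ / ℓ →
         Step V s ⟨ idx s - j , update (sets s) j S ⟩

initial : ∀ {n ℓ} → State n ℓ
initial = ⟨ ⊤ , (λ _ → ⊥) ⟩

data Reach {n ℓ : ℕ} .{{_ : NonZero ℓ}} (V : Fin ℓ → Subset n) : ℕ → State n ℓ → Set where
  start : Reach V zero initial
  next  : ∀ {k s s′} → Reach V k s → Step V s s′ → Reach V (suc k) s′

{-# OPTIONS --safe #-}
module Submission where

-- Indices leave I in increasing order of |V_j|, so after k rounds every chosen
-- set has ⌊|V_i|/ℓ⌋ ≤ ⌊|V_j|/ℓ⌋ elements for each j still in I, and their union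
-- has at most k⌊|V_j|/ℓ⌋ elements.  As ℓ⌊|V_j|/ℓ⌋ ≤ |V_j|, at least ⌊|V_j|/ℓ⌋
-- elements of V_j remain available while k < ℓ.  For the size bound, v ≥ ℓ
-- gives ⌊v/ℓ⌋ ≥ 1, hence v < ℓ(⌊v/ℓ⌋ + 1) ≤ 2ℓ⌊v/ℓ⌋.

open import Defs
open import Data.Nat using (ℕ; zero; suc; _+_; _*_; _≤_; _<_; _≤?_; z≤n; s≤s; NonZero; >-nonZero)
open import Data.Nat.Properties hiding (_≟_)
open import Data.Nat.DivMod using (_/_; _%_; m≡m%n+[m/n]*n; m%n<n; m/n*n≤m; /-monoˡ-≤; m≥n⇒m/n>0)
open import Data.Nat.Solver using (module +-*-Solver)
open import Data.Fin using (Fin; zero; suc)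
open import Data.Fin.Properties using (_≟_)
open import Data.Fin.Subset using (Subset; inside; outside; _∈_; _∉_; _⊆_; _∩_; _∪_; _─_; _-_; ∣_∣; Empty)
  renaming (⊥ to ∅)
open import Data.Fin.Subset.Properties
open import Data.Vec.Base using (_∷_; []; here; there)
open import Data.Product using (Σ; _×_; _,_; proj₁; proj₂)
open import Data.Sum using (_⊎_; inj₁; inj₂)
open import Data.Empty using (⊥-elim)
open import Relation.Nullary using (yes; no; contradiction)
open import Relation.Binary.PropositionalEquality using (_≡_; _≢_; refl; sym; trans; cong; subst)

∣p∪q∣≤∣p∣+∣q∣ : ∀ {m} (p q : Subset m) → ∣ p ∪ q ∣ ≤ ∣ p ∣ + ∣ q ∣
∣p∪q∣≤∣p∣+∣q∣ []           []           = z≤n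
∣p∪q∣≤∣p∣+∣q∣ (inside ∷ p)  (inside ∷ q)  =
  s≤s (≤-trans (∣p∪q∣≤∣p∣+∣q∣ p q) (+-monoʳ-≤ ∣ p ∣ (n≤1+n ∣ q ∣)))
∣p∪q∣≤∣p∣+∣q∣ (inside ∷ p)  (outside ∷ q) =
  s≤s (∣p∪q∣≤∣p∣+∣q∣ p q)
∣p∪q∣≤∣p∣+∣q∣ (outside ∷ p) (inside ∷ q)  =
  ≤-trans (s≤s (∣p∪q∣≤∣p∣+∣q∣ p q)) (≤-reflexive (sym (+-suc ∣ p ∣ ∣ q ∣)))
∣p∪q∣≤∣p∣+∣q∣ (outside ∷ p) (outside ∷ q) =
  ∣p∪q∣≤∣p∣+∣q∣ p q

p⊆[p─q]∪q : ∀ {m} (p q : Subset m) → p ⊆ (p ─ q) ∪ q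
p⊆[p─q]∪q p q {x} x∈p with x ∈? q
... | yes x∈q = x∈p∪q⁺ (inj₂ x∈q)
... | no  x∉q = x∈p∪q⁺ (inj₁ (x∈p∧x∉q⇒x∈p─q x∈p x∉q))

x∈p─q⇒x∉q : ∀ {m} (p q : Subset m) {x} → x ∈ p ─ q → x ∉ q
x∈p─q⇒x∉q (_ ∷ p) (_ ∷ q)      (there x∈p─q) (there x∈q) = x∈p─q⇒x∉q p q x∈p─q x∈q
x∈p─q⇒x∉q (_ ∷ p) (inside ∷ q) {zero} ()

suc∣p-x∣≡∣p∣ : ∀ {m} (p : Subset m) {x} → x ∈ p → suc ∣ p - x ∣ ≡ ∣ p ∣
suc∣p-x∣≡∣p∣ (inside ∷ p)  here        = cong (λ r → suc ∣ r ∣) (p─⊥≡p p)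
suc∣p-x∣≡∣p∣ (inside ∷ p)  (there x∈p) = cong suc (suc∣p-x∣≡∣p∣ p x∈p)
suc∣p-x∣≡∣p∣ (outside ∷ p) (there x∈p) = suc∣p-x∣≡∣p∣ p x∈p

subsetOfSize : ∀ {m} (A : Subset m) k → k ≤ ∣ A ∣ → Σ (Subset m) λ S → S ⊆ A × ∣ S ∣ ≡ k
subsetOfSize {m} A zero _ = ∅ , (λ x∈∅ → contradiction x∈∅ ∉⊥) , ∣⊥∣≡0 m
subsetOfSize (inside ∷ A) (suc k) (s≤s k≤∣A∣) with subsetOfSize A k k≤∣A∣
... | S , S⊆A , ∣S∣≡k = inside ∷ S , in⊆in S⊆A , cong suc ∣S∣≡k
subsetOfSize (outside ∷ A) (suc k) k<∣A∣ with subsetOfSize A (suc k) k<∣A∣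
... | S , S⊆A , ∣S∣≡k = outside ∷ S , out⊆ S⊆A , ∣S∣≡k

Argmin : ∀ {m} → (Fin m → ℕ) → Subset m → Fin m → Set
Argmin f I j = j ∈ I × (∀ j′ → j′ ∈ I → f j ≤ f j′)

argmin? : ∀ {m} (f : Fin m → ℕ) (I : Subset m) → Empty I ⊎ Σ (Fin m) (Argmin f I)
argmin? f [] = inj₁ λ { (() , _) }
argmin? f (b ∷ I) with argmin? (λ i → f (suc i)) I
argmin? f (outside ∷ I) | inj₁ I-empty = inj₁ λ { (suc x , there x∈I) → I-empty (x , x∈I) }
argmin? f (inside ∷ I)  | inj₁ I-empty =
  inj₂ (zero , here , λ { zero _ → ≤-refl ; (suc x) (there x∈I) → ⊥-elim (I-empty (x , x∈I)) })
argmin? f (outside ∷ I) | inj₂ (j , j∈I , j-min) =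
  inj₂ (suc j , there j∈I , λ { (suc x) (there x∈I) → j-min x x∈I })
argmin? f (inside ∷ I)  | inj₂ (j , j∈I , j-min) with f zero ≤? f (suc j)
... | yes f0≤fj =
  inj₂ (zero , here , λ { zero _ → ≤-refl ; (suc x) (there x∈I) → ≤-trans f0≤fj (j-min x x∈I) })
... | no  f0≰fj =
  inj₂ (suc j , there j∈I , λ { zero _ → ≰⇒≥ f0≰fj ; (suc x) (there x∈I) → j-min x x∈I })

n≤m⇒m≤2*n*[m/n] : ∀ {m n} .{{_ : NonZero n}} → n ≤ m → m ≤ 2 * n * (m / n)
n≤m⇒m≤2*n*[m/n] {m} {n} n≤m = begin
  m                   ≡⟨ m≡m%n+[m/n]*n m n ⟩
  m % n + q * n       ≤⟨ +-monoˡ-≤ (q * n) (<⇒≤ (m%n<n m n)) ⟩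
  n + q * n           ≤⟨ +-monoˡ-≤ (q * n) (m≤n*m n q) ⟩
  q * n + q * n       ≡⟨ solve 2 (λ x y → x :* y :+ x :* y := con 2 :* y :* x) refl q n ⟩
  2 * n * q           ∎
  where
  open ≤-Reasoning
  open +-*-Solver
  q = m / n
  instance
    q-nonZero : NonZero q
    q-nonZero = >-nonZero (m≥n⇒m/n>0 n≤m)

∈bigUnion⁺ : ∀ {m k} (W : Fin k → Subset m) i {x} → x ∈ W i → x ∈ bigUnion W
∈bigUnion⁺ W zero    x∈W = x∈p∪q⁺ (inj₁ x∈W)
∈bigUnion⁺ W (suc i) x∈W = x∈p∪q⁺ (inj₂ (∈bigUnion⁺ (λ i → W (suc i)) i x∈W))

∈bigUnion⁻ : ∀ {m k} (W : Fin k → Subset m) {x} → x ∈ bigUnion W → Σ (Fin k) λ i → x ∈ W i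
∈bigUnion⁻ {k = zero}  W x∈⋃ = contradiction x∈⋃ ∉⊥
∈bigUnion⁻ {k = suc k} W x∈⋃ with x∈p∪q⁻ (W zero) (bigUnion (λ i → W (suc i))) x∈⋃
... | inj₁ x∈W₀ = zero , x∈W₀
... | inj₂ x∈⋃′ with ∈bigUnion⁻ (λ i → W (suc i)) x∈⋃′
...   | i , x∈Wᵢ = suc i , x∈Wᵢ

update-elim : ∀ {m k p} (P : Fin k → Subset m → Set p) {W : Fin k → Subset m} {j S} →
              P j S → (∀ l → l ≢ j → P l (W l)) → ∀ l → P l (update W j S l)
update-elim P {j = j} P-new P-old l with l ≟ j
... | yes refl = P-new
... | no  l≢j  = P-old l l≢j

∈-update⁻ : ∀ {m k} (W : Fin k → Subset m) j S l {x} →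
            x ∈ update W j S l → (l ≡ j × x ∈ S) ⊎ x ∈ W l
∈-update⁻ W j S l {x} =
  update-elim (λ l X → x ∈ X → (l ≡ j × x ∈ S) ⊎ x ∈ W l)
              (λ x∈S → inj₁ (refl , x∈S)) (λ _ _ → inj₂) l

bigUnion-update : ∀ {m k} (W : Fin k → Subset m) j S → bigUnion (update W j S) ⊆ bigUnion W ∪ S
bigUnion-update W j S x∈⋃ with ∈bigUnion⁻ (update W j S) x∈⋃
... | l , x∈Wₗ with ∈-update⁻ W j S l x∈Wₗ
...   | inj₁ (_ , x∈S) = x∈p∪q⁺ (inj₂ x∈S)
...   | inj₂ x∈Wₗ′     = x∈p∪q⁺ (inj₁ (∈bigUnion⁺ W l x∈Wₗ′))

PairwiseDisjoint : ∀ {m k} → (Fin k → Subset m) → Set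
PairwiseDisjoint W = ∀ {x} l l′ → x ∈ W l → x ∈ W l′ → l ≡ l′

update-pairwiseDisjoint : ∀ {m k} {W : Fin k → Subset m} j {S} → PairwiseDisjoint W →
                          (∀ {x} → x ∈ S → x ∉ bigUnion W) → PairwiseDisjoint (update W j S)
update-pairwiseDisjoint {W = W} j {S} W-disjoint S-fresh l l′ x∈l x∈l′
  with ∈-update⁻ W j S l x∈l | ∈-update⁻ W j S l′ x∈l′
... | inj₁ (l≡j , _)  | inj₁ (l′≡j , _) = trans l≡j (sym l′≡j)
... | inj₁ (_ , x∈S)  | inj₂ x∈Wₗ′     = contradiction (∈bigUnion⁺ W l′ x∈Wₗ′) (S-fresh x∈S)
... | inj₂ x∈Wₗ       | inj₁ (_ , x∈S) = contradiction (∈bigUnion⁺ W l x∈Wₗ) (S-fresh x∈S)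
... | inj₂ x∈Wₗ       | inj₂ x∈Wₗ′     = W-disjoint l l′ x∈Wₗ x∈Wₗ′

module Distribute (n ℓ : ℕ) .{{_ : NonZero ℓ}} (V : Fin ℓ → Subset n) where

  record Invariant (k : ℕ) (s : State n ℓ) : Set where
    field
      remaining : ∣ idx s ∣ + k ≡ ℓ
      chosen    : ∀ l → l ∉ idx s → sets s l ⊆ V l × ∣ sets s l ∣ ≡ ∣ V l ∣ / ℓ
      disjoint  : PairwiseDisjoint (sets s)
      covered   : ∀ j → j ∈ idx s → ∣ bigUnion (sets s) ∣ ≤ k * (∣ V j ∣ / ℓ)
  open Invariant

  invariant-initial : Invariant 0 initial
  invariant-initial = record
    { remaining = trans (+-identityʳ _) (∣⊤∣≡n ℓ)
    ; chosen    = λ l l∉full → contradiction ∈⊤ l∉full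
    ; disjoint  = λ l l′ x∈∅ _ → contradiction x∈∅ ∉⊥
    ; covered   = λ _ _ → ≤-trans (p⊆q⇒∣p∣≤∣q∣ ⋃∅⊆∅) (≤-reflexive (∣⊥∣≡0 n))
    }
    where
    ⋃∅⊆∅ : bigUnion (sets (initial {n} {ℓ})) ⊆ ∅
    ⋃∅⊆∅ x∈⋃ = proj₂ (∈bigUnion⁻ (sets (initial {n} {ℓ})) x∈⋃)

  invariant-step : ∀ {k s s′} → Invariant k s → Step V s s′ → Invariant (suc k) s′
  invariant-step {k} inv (step s j S (j∈I , j-min) S⊆avail ∣S∣≡q) = record
    { remaining = trans (+-suc _ k) (trans (cong (_+ k) (suc∣p-x∣≡∣p∣ (idx s) j∈I)) (remaining inv))
    ; chosen    = update-elim (λ l X → l ∉ idx s - j → X ⊆ V l × ∣ X ∣ ≡ ∣ V l ∣ / ℓ)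
                    (λ _ → S⊆Vⱼ , ∣S∣≡q)
                    (λ l l≢j l∉I-j → chosen inv l (λ l∈I → l∉I-j (x∈p∧x≢y⇒x∈p-y l∈I l≢j)))
    ; disjoint  = update-pairwiseDisjoint j (disjoint inv) (λ x∈S → x∈p─q⇒x∉q (V j) U (S⊆avail x∈S))
    ; covered   = covered′
    }
    where
    U = bigUnion (sets s)
    q = ∣ V j ∣ / ℓ

    S⊆Vⱼ : S ⊆ V j
    S⊆Vⱼ x∈S = p─q⊆p (V j) U (S⊆avail x∈S)

    covered′ : ∀ j′ → j′ ∈ idx s - j → ∣ bigUnion (update (sets s) j S) ∣ ≤ suc k * (∣ V j′ ∣ / ℓ)
    covered′ j′ j′∈I-j = begin
      ∣ bigUnion (update (sets s) j S) ∣ ≤⟨ p⊆q⇒∣p∣≤∣q∣ (bigUnion-update (sets s) j S) ⟩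
      ∣ U ∪ S ∣                         ≤⟨ ∣p∪q∣≤∣p∣+∣q∣ U S ⟩
      ∣ U ∣ + ∣ S ∣                     ≤⟨ +-mono-≤ (covered inv j j∈I) (≤-reflexive ∣S∣≡q) ⟩
      k * q + q                         ≡⟨ +-comm (k * q) q ⟩
      suc k * q                         ≤⟨ *-monoʳ-≤ (suc k) (/-monoˡ-≤ ℓ (j-min j′ j′∈I)) ⟩
      suc k * (∣ V j′ ∣ / ℓ)            ∎
      where
      open ≤-Reasoning
      j′∈I = p─q⊆p (idx s) _ j′∈I-j

  reach⇒invariant : ∀ {k s} → Reach V k s → Invariant k s
  reach⇒invariant start        = invariant-initial
  reach⇒invariant (next r st) = invariant-step (reach⇒invariant r) st

  argmin-exists : ∀ {k s} → k < ℓ → Invariant k s → Σ (Fin ℓ) (IsArgmin V (idx s))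
  argmin-exists {k} {s} k<ℓ inv with argmin? (λ j → ∣ V j ∣) (idx s)
  ... | inj₂ argmin = argmin
  ... | inj₁ I-empty = contradiction (sym ℓ≡k) (<⇒≢ k<ℓ)
    where
    ∣I∣≡0 : ∣ idx s ∣ ≡ 0
    ∣I∣≡0 = trans (cong ∣_∣ (Empty-unique I-empty)) (∣⊥∣≡0 ℓ)
    ℓ≡k : ℓ ≡ k
    ℓ≡k = trans (sym (remaining inv)) (cong (_+ k) ∣I∣≡0)

  available-large : ∀ {k s j} → k < ℓ → Invariant k s → j ∈ idx s →
                    ∣ V j ∣ / ℓ ≤ ∣ Available V s j ∣
  available-large {k} {s} {j} k<ℓ inv j∈I = +-cancelʳ-≤ (k * q) q a (begin
    suc k * q         ≤⟨ *-monoˡ-≤ q k<ℓ ⟩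
    ℓ * q             ≡⟨ *-comm ℓ q ⟩
    q * ℓ             ≤⟨ m/n*n≤m ∣ V j ∣ ℓ ⟩
    ∣ V j ∣           ≤⟨ p⊆q⇒∣p∣≤∣q∣ (p⊆[p─q]∪q (V j) U) ⟩
    ∣ (V j ─ U) ∪ U ∣ ≤⟨ ∣p∪q∣≤∣p∣+∣q∣ (V j ─ U) U ⟩
    a + ∣ U ∣         ≤⟨ +-monoʳ-≤ a (covered inv j j∈I) ⟩
    a + k * q         ∎)
    where
    open ≤-Reasoning
    q = ∣ V j ∣ / ℓ
    U = bigUnion (sets s)
    a = ∣ Available V s j ∣

  all-chosen : ∀ {s} → Invariant ℓ s → ∀ l → l ∉ idx s
  all-chosen {s} inv l l∈I = n≮0 (subst (∣ idx s - l ∣ <_) ∣I∣≡0 (x∈p⇒∣p-x∣<∣p∣ l∈I))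
    where
    ∣I∣≡0 : ∣ idx s ∣ ≡ 0
    ∣I∣≡0 = +-cancelʳ-≡ ℓ ∣ idx s ∣ 0 (remaining inv)

  well-defined : (k : ℕ) (s : State n ℓ) → k < ℓ → Reach V k s →
                 Σ (Fin ℓ) (λ j → IsArgmin V (idx s) j)
                 × (∀ j → IsArgmin V (idx s) j →
                      Σ (Subset n) (λ S → S ⊆ Available V s j × ∣ S ∣ ≡ ∣ V j ∣ / ℓ))
  well-defined k s k<ℓ r =
    argmin-exists k<ℓ inv ,
    λ j (j∈I , _) → subsetOfSize (Available V s j) (∣ V j ∣ / ℓ) (available-large k<ℓ inv j∈I)
    where inv = reach⇒invariant r

  correct : (∀ l → 2 * ℓ ≤ ∣ V l ∣) → (s : State n ℓ) → Reach V ℓ s →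
            (∀ l l′ → l ≢ l′ → Empty (sets s l ∩ sets s l′))
            × (∀ l → sets s l ⊆ V l)
            × (∀ l → ∣ V l ∣ ≤ 2 * ℓ * ∣ sets s l ∣)
  correct large s r = separated , (λ l → proj₁ (final l)) , size-bound
    where
    inv = reach⇒invariant r

    final : ∀ l → sets s l ⊆ V l × ∣ sets s l ∣ ≡ ∣ V l ∣ / ℓ
    final l = chosen inv l (all-chosen inv l)

    separated : ∀ l l′ → l ≢ l′ → Empty (sets s l ∩ sets s l′)
    separated l l′ l≢l′ (x , x∈∩) = l≢l′ (disjoint inv l l′ (proj₁ x∈both) (proj₂ x∈both))
      where x∈both = x∈p∩q⁻ (sets s l) (sets s l′) x∈∩

    size-bound : ∀ l → ∣ V l ∣ ≤ 2 * ℓ * ∣ sets s l ∣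
    size-bound l rewrite proj₂ (final l) = n≤m⇒m≤2*n*[m/n] (≤-trans (m≤n*m ℓ 2) (large l))

lemmaG1 : (n ℓ : ℕ) .{{_ : NonZero ℓ}} (V : Fin ℓ → Subset n) →
          (∀ l → 2 * ℓ ≤ ∣ V l ∣) →
          ((k : ℕ) (s : State n ℓ) → k < ℓ → Reach V k s →
             Σ (Fin ℓ) (λ j → IsArgmin V (idx s) j)
             × (∀ j → IsArgmin V (idx s) j →
                  Σ (Subset n) (λ S → S ⊆ Available V s j × ∣ S ∣ ≡ ∣ V j ∣ / ℓ)))
          × ((s : State n ℓ) → Reach V ℓ s →
             (∀ l l′ → l ≢ l′ → Empty (sets s l ∩ sets s l′))
             × (∀ l → sets s l ⊆ V l)
             × (∀ l → ∣ V l ∣ ≤ 2 * ℓ * ∣ sets s l ∣))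
lemmaG1 n ℓ V large = Distribute.well-defined n ℓ V , Distribute.correct n ℓ V large
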